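{- Let $k\ge 3$ and let $u_i$ be an outer vertex and $v_j$ an inner vertex of $GP(2k,2)$ with $r=|i-j|\le k$. Then the number $\sigma(u_i,v_j)$ of geodesics between $u_i$ and $v_j$ is $1$ if $r<k$ and $2$ if $r=k$.
   Context: For an integer $n\ge 5$, $GP(n,2)$ is the graph with vertex set $\{u_0,\dots,u_{n-1},v_0,\dots,v_{n-1}\}$ and edges $u_iu_{i+1}$ (outer edges), $u_iv_i$ (spokes) and $v_iv_{i+2}$ (inner edges) for $0\le i\le n-1$, subscripts modulo $n$. The $u_i$ are outer vertices, the $v_i$ inner vertices. A geodesic is a shortest path; $\sigma(x,y)$ denotes the number of geodesics between $x$ and $y$. -}

module Defs where

open import Data.Nat using (ℕ; _+_; _≤_)
open import Data.Fin using (Fin; toℕ)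
open import Data.List using (List; []; _∷_; length)
open import Data.List.Membership.Propositional using (_∈_)
open import Data.List.Relation.Unary.All using (All)
open import Data.List.Relation.Unary.Unique.Propositional using (Unique)
open import Data.Product using (Σ; _×_)
open import Data.Sum using (_⊎_)
open import Relation.Binary.PropositionalEquality using (_≡_)

data V (n : ℕ) : Set where
  u : Fin n → V n
  v : Fin n → V n

-- Step n s a b : b ≡ a + s (mod n), for a b < n and s < n.
Step : (n s : ℕ) → Fin n → Fin n → Set
Step n s a b = (toℕ b ≡ toℕ a + s) ⊎ (toℕ b + n ≡ toℕ a + s)

Adj : (n : ℕ) → V n → V n → Set
Adj n (u i) (u j) = Step n 1 i j ⊎ Step n 1 j i
Adj n (u i) (v j) = i ≡ j
Adj n (v i) (u j) = i ≡ j
Adj n (v i) (v j) = Step n 2 i j ⊎ Step n 2 j i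

-- IsWalk n x y ps : ps is the vertex sequence of a walk from x to y.
-- Its length (number of edges) is length ps ∸ 1.
data IsWalk (n : ℕ) : V n → V n → List (V n) → Set where
  here : ∀ {x} → IsWalk n x x (x ∷ [])
  step : ∀ {x y z ps} → Adj n x y → IsWalk n y z ps → IsWalk n x z (x ∷ ps)

IsGeodesic : (n : ℕ) → V n → V n → List (V n) → Set
IsGeodesic n x y ps =
  IsWalk n x y ps × (∀ qs → IsWalk n x y qs → length ps ≤ length qs)

NumGeodesics : (n : ℕ) → V n → V n → ℕ → Set
NumGeodesics n x y m =
  Σ (List (List (V n))) λ gs →
    (length gs ≡ m) × Unique gs × All (IsGeodesic n x y) gs ×
    (∀ ps → IsGeodesic n x y ps → ps ∈ gs)

module Submission where

-- A walk in GP(n,2) lifts to the infinite ladder GP(ℤ,2); its displacement D (±1 per outer edge,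
-- ±2 per inner edge, 0 per spoke) satisfies i + D ≡ j (mod n) for a walk from u_i to v_j.
-- In the ladder a walk from an outer vertex to the inner vertex D further along has at least
-- 2 + ⌈|D|/2⌉ vertices, and a walk attaining this bound is determined by D, because D forces its
-- first edge. So the geodesics from u_i to v_j are the tight lifts whose displacement minimises
-- ⌈|D|/2⌉ in the class of j − i modulo 2k: only D = j − i when r < k, and D = ±k when r = k.
-- For n ≥ 5 the vertex sequence of a walk determines its displacement, so these lifts are distinct.

open import Defs
open import Data.Nat using (ℕ; _*_; _≤_; _<_; ∣_-_∣)
open import Data.Fin using (Fin; toℕ)
open import Relation.Binary.PropositionalEquality using (_≡_)
open import Data.Product using (_×_)

open import Data.Empty using (⊥; ⊥-elim)
open import Data.Fin using (fromℕ<)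
open import Data.Fin.Properties using (toℕ<n; toℕ-injective; toℕ-fromℕ<)
open import Data.Integer as ℤ using (ℤ; +_; -[1+_]; +0; +[1+_]; ∣_∣)
import Data.Integer.Properties as ℤₚ
open import Algebra.Properties.AbelianGroup ℤₚ.+-0-abelianGroup using () renaming (∙-cancelˡ to +-cancelˡ-ℤ)
open import Data.Integer.Tactic.RingSolver using (solve-∀)
open import Data.List using (List; []; _∷_; length)
open import Data.List.Relation.Unary.All using ([]; _∷_)
open import Data.List.Relation.Unary.AllPairs using ([]; _∷_)
open import Data.List.Relation.Unary.Any using (here; there)
open import Data.Nat as ℕ using (zero; suc; _+_; _∸_; z≤n; s≤s; _⊔_; ⌈_/2⌉; _<?_; _≤?_)
open import Data.Nat.Properties
open import Data.Product using (Σ; _,_; proj₁; proj₂; uncurry; map₁)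
open import Data.Sum using (_⊎_; inj₁; inj₂; map₂; [_,_]′)
open import Relation.Binary.PropositionalEquality using (_≢_; refl; sym; trans; cong; cong₂; subst; module ≡-Reasoning)
open import Relation.Nullary using (¬_; yes; no)

-- Congruences of integers

infix 4 _≡_mod_

record _≡_mod_ (a b : ℤ) (n : ℕ) : Set where
  constructor congruent
  field
    quotient : ℤ
    equation : a ≡ b ℤ.+ quotient ℤ.* + n

mod-reflexive : ∀ {a b n} → a ≡ b → a ≡ b mod n
mod-reflexive {a} {n = n} refl = congruent (+ 0) (lemma a (+ n))
  where
  lemma : ∀ a n → a ≡ a ℤ.+ + 0 ℤ.* n
  lemma = solve-∀

mod-sym : ∀ {a b n} → a ≡ b mod n → b ≡ a mod n
mod-sym {b = b} {n} (congruent m refl) = congruent (ℤ.- m) (lemma b m (+ n))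
  where
  lemma : ∀ b m n → b ≡ b ℤ.+ m ℤ.* n ℤ.+ ℤ.- m ℤ.* n
  lemma = solve-∀

mod-trans : ∀ {a b c n} → a ≡ b mod n → b ≡ c mod n → a ≡ c mod n
mod-trans {c = c} {n} (congruent m refl) (congruent m′ refl) = congruent (m′ ℤ.+ m) (lemma c m m′ (+ n))
  where
  lemma : ∀ c m m′ n → c ℤ.+ m′ ℤ.* n ℤ.+ m ℤ.* n ≡ c ℤ.+ (m′ ℤ.+ m) ℤ.* n
  lemma = solve-∀

mod-+ : ∀ {a b c d n} → a ≡ b mod n → c ≡ d mod n → a ℤ.+ c ≡ b ℤ.+ d mod n
mod-+ {b = b} {d = d} {n = n} (congruent m refl) (congruent m′ refl) =
  congruent (m ℤ.+ m′) (lemma b d m m′ (+ n))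
  where
  lemma : ∀ b d m m′ n → b ℤ.+ m ℤ.* n ℤ.+ (d ℤ.+ m′ ℤ.* n) ≡ b ℤ.+ d ℤ.+ (m ℤ.+ m′) ℤ.* n
  lemma = solve-∀

mod-neg : ∀ {a b n} → a ≡ b mod n → ℤ.- a ≡ ℤ.- b mod n
mod-neg {b = b} {n} (congruent m refl) = congruent (ℤ.- m) (lemma b m (+ n))
  where
  lemma : ∀ b m n → ℤ.- (b ℤ.+ m ℤ.* n) ≡ ℤ.- b ℤ.+ ℤ.- m ℤ.* n
  lemma = solve-∀

mod-resp : ∀ {a a′ b b′ n} → a ≡ a′ → b ≡ b′ → a ≡ b mod n → a′ ≡ b′ mod n
mod-resp refl refl a≡b = a≡b

mod-flip : ∀ {s a b n} → s ≡ a ℤ.- b mod n → ℤ.- s ≡ b ℤ.- a mod n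
mod-flip {a = a} {b} s≡a-b = mod-resp refl (lemma a b) (mod-neg s≡a-b)
  where
  lemma : ∀ a b → ℤ.- (a ℤ.- b) ≡ b ℤ.- a
  lemma = solve-∀

mod-cancelʳ : ∀ {a b c n} → a ℤ.- c ≡ b ℤ.- c mod n → a ≡ b mod n
mod-cancelʳ {a} {b} {c} a-c≡b-c =
  mod-resp (lemma a c) (lemma b c) (mod-+ a-c≡b-c (mod-reflexive {a = c} refl))
  where
  lemma : ∀ a c → a ℤ.- c ℤ.+ c ≡ a
  lemma = solve-∀

∣+m-+n∣≡∣m-n∣ : ∀ m n → ∣ + m ℤ.- + n ∣ ≡ ∣ m - n ∣
∣+m-+n∣≡∣m-n∣ m n with ≤-total m n
... | inj₁ m≤n = begin
  ∣ + m ℤ.- + n ∣  ≡⟨ cong ∣_∣ (ℤₚ.m-n≡m⊖n m n) ⟩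
  ∣ m ℤ.⊖ n ∣      ≡⟨ ℤₚ.∣⊖∣-≤ m≤n ⟩
  n ∸ m            ≡⟨ m≤n⇒∣m-n∣≡n∸m m≤n ⟨
  ∣ m - n ∣        ∎
  where open ≡-Reasoning
... | inj₂ n≤m = begin
  ∣ + m ℤ.- + n ∣  ≡⟨ cong ∣_∣ (ℤₚ.m-n≡m⊖n m n) ⟩
  ∣ m ℤ.⊖ n ∣      ≡⟨ ℤₚ.∣m⊖n∣≡∣n⊖m∣ m n ⟩
  ∣ n ℤ.⊖ m ∣      ≡⟨ ℤₚ.∣⊖∣-≤ n≤m ⟩
  m ∸ n            ≡⟨ m≤n⇒∣n-m∣≡n∸m n≤m ⟨
  ∣ m - n ∣        ∎
  where open ≡-Reasoning

∣a-b∣≡∣quotient∣*n : ∀ {a b n} (a≡b : a ≡ b mod n) →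
                     ∣ a ℤ.- b ∣ ≡ ∣ _≡_mod_.quotient a≡b ∣ ℕ.* n
∣a-b∣≡∣quotient∣*n {b = b} {n} (congruent m refl) = trans (cong ∣_∣ (lemma b m (+ n))) (ℤₚ.abs-* m (+ n))
  where
  lemma : ∀ b m n → b ℤ.+ m ℤ.* n ℤ.- b ≡ m ℤ.* n
  lemma = solve-∀

mod-apart : ∀ {a b n} → a ≡ b mod n → a ≡ b ⊎ n ≤ ∣ a ℤ.- b ∣
mod-apart {b = b} {n} (congruent +0 refl) = inj₁ (lemma b (+ n))
  where
  lemma : ∀ b n → b ℤ.+ + 0 ℤ.* n ≡ b
  lemma = solve-∀
mod-apart {n = n} a≡b@(congruent +[1+ t ] refl) =
  inj₂ (subst (n ≤_) (sym (∣a-b∣≡∣quotient∣*n a≡b)) (m≤m+n n (t ℕ.* n)))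
mod-apart {n = n} a≡b@(congruent -[1+ t ] refl) =
  inj₂ (subst (n ≤_) (sym (∣a-b∣≡∣quotient∣*n a≡b)) (m≤m+n n (t ℕ.* n)))

mod-injective : ∀ {x y n} → x < n → y < n → + x ≡ + y mod n → x ≡ y
mod-injective {x} {y} {n} x<n y<n x≡y with mod-apart x≡y
... | inj₁ +x≡+y   = ℤₚ.+-injective +x≡+y
... | inj₂ n≤∣x-y∣ = ⊥-elim (<-irrefl refl (begin-strict
  n                 ≤⟨ n≤∣x-y∣ ⟩
  ∣ + x ℤ.- + y ∣   ≡⟨ ∣+m-+n∣≡∣m-n∣ x y ⟩
  ∣ x - y ∣         ≤⟨ ∣m-n∣≤m⊔n x y ⟩
  x ⊔ y             <⟨ ⊔-lub x<n y<n ⟩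
  n                 ∎))
  where open ≤-Reasoning

-- Half distances

halfDist : ℤ → ℕ
halfDist D = ⌈ ∣ D ∣ /2⌉

halfDist-+-≤ : ∀ s D → ∣ s ∣ ≤ 2 → halfDist (s ℤ.+ D) ≤ suc (halfDist D)
halfDist-+-≤ s D ∣s∣≤2 =
  ⌈n/2⌉-mono (≤-trans (ℤₚ.∣i+j∣≤∣i∣+∣j∣ s D) (+-monoˡ-≤ ∣ D ∣ ∣s∣≤2))

⌈1+n/2⌉≡1+⌈n/2⌉⇒even : ∀ n → ⌈ suc n /2⌉ ≡ suc ⌈ n /2⌉ → Σ ℕ λ e → n ≡ 2 * e
⌈1+n/2⌉≡1+⌈n/2⌉⇒even zero          _  = 0 , refl
⌈1+n/2⌉≡1+⌈n/2⌉⇒even (suc zero)    ()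
⌈1+n/2⌉≡1+⌈n/2⌉⇒even (suc (suc n)) eq with ⌈1+n/2⌉≡1+⌈n/2⌉⇒even n (suc-injective eq)
... | e , refl = suc e , sym (*-suc 2 e)

⌈n/2⌉≡⌈1+n/2⌉⇒odd : ∀ n → ⌈ n /2⌉ ≡ ⌈ suc n /2⌉ → Σ ℕ λ e → n ≡ suc (2 * e)
⌈n/2⌉≡⌈1+n/2⌉⇒odd zero          ()
⌈n/2⌉≡⌈1+n/2⌉⇒odd (suc zero)    _  = 0 , refl
⌈n/2⌉≡⌈1+n/2⌉⇒odd (suc (suc n)) eq with ⌈n/2⌉≡⌈1+n/2⌉⇒odd n (suc-injective eq)
... | e , refl = suc e , cong suc (sym (*-suc 2 e))

n≢2+n : ∀ {n} → n ≢ suc (suc n)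
n≢2+n ()

≤⇒≢1+ : ∀ {m n} → m ≤ n → m ≢ suc n
≤⇒≢1+ m≤n refl = <-irrefl refl m≤n

halfDist-tight-+1 : ∀ D → halfDist (+ 1 ℤ.+ D) ≡ suc (halfDist D) →
                    Σ ℕ λ e → + 1 ℤ.+ D ≡ + suc (2 * e)
halfDist-tight-+1 (+ p) eq with ⌈1+n/2⌉≡1+⌈n/2⌉⇒even p eq
... | e , refl = e , refl
halfDist-tight-+1 -[1+ zero ]  ()
halfDist-tight-+1 -[1+ suc q ] eq = ⊥-elim (≤⇒≢1+ (⌈n/2⌉-mono (n≤1+n (suc q))) eq)

halfDist-tight--1 : ∀ D → halfDist (-[1+ 0 ] ℤ.+ D) ≡ suc (halfDist D) →
                    Σ ℕ λ e → -[1+ 0 ] ℤ.+ D ≡ -[1+ 2 * e ]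
halfDist-tight--1 (+ zero)    _  = 0 , refl
halfDist-tight--1 (+ suc p)   eq = ⊥-elim (≤⇒≢1+ (⌈n/2⌉-mono (n≤1+n p)) eq)
halfDist-tight--1 -[1+ p ]    eq with ⌈n/2⌉≡⌈1+n/2⌉⇒odd p (suc-injective eq)
... | e , refl = suc e , cong -[1+_] (sym (*-suc 2 e))

halfDist-tight-+2 : ∀ D → halfDist (+ 2 ℤ.+ D) ≡ suc (halfDist D) →
                    Σ ℕ λ e → + 2 ℤ.+ D ≡ + suc e
halfDist-tight-+2 (+ p)                _  = suc p , refl
halfDist-tight-+2 -[1+ zero ]          _  = 0 , refl
halfDist-tight-+2 -[1+ suc zero ]      ()
halfDist-tight-+2 -[1+ suc (suc q) ]   eq = ⊥-elim (n≢2+n eq)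

halfDist-tight--2 : ∀ D → halfDist (-[1+ 1 ] ℤ.+ D) ≡ suc (halfDist D) →
                    Σ ℕ λ e → -[1+ 1 ] ℤ.+ D ≡ -[1+ e ]
halfDist-tight--2 (+ zero)          _  = 1 , refl
halfDist-tight--2 (+ suc zero)      _  = 0 , refl
halfDist-tight--2 (+ suc (suc p))   eq = ⊥-elim (n≢2+n eq)
halfDist-tight--2 -[1+ p ]          _  = suc (suc p) , refl

halfDist-neg : ∀ D → halfDist (ℤ.- D) ≡ halfDist D
halfDist-neg D = cong ⌈_/2⌉ (ℤₚ.∣-i∣≡∣i∣ D)

⌈1+n+n/2⌉≡1+⌈n+n/2⌉ : ∀ n → ⌈ suc (n + n) /2⌉ ≡ suc ⌈ n + n /2⌉
⌈1+n+n/2⌉≡1+⌈n+n/2⌉ n = cong suc (trans (sym (n≡⌊n+n/2⌋ n)) (n≡⌈n+n/2⌉ n))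

-[1+m]-n≡-[1+m+n] : ∀ m n → -[1+ m ] ℤ.- + n ≡ -[1+ m + n ]
-[1+m]-n≡-[1+m+n] m zero    = cong -[1+_] (sym (+-identityʳ m))
-[1+m]-n≡-[1+m+n] m (suc n) = cong -[1+_] (sym (+-suc m n))

parity : ∀ q → Σ ℕ λ m → q ≡ m + m ⊎ q ≡ suc (m + m)
parity zero = 0 , inj₁ refl
parity (suc q) with parity q
... | m , inj₁ refl = m , inj₂ refl
... | m , inj₂ refl = suc m , inj₁ (cong suc (sym (+-suc m m)))

Even : ℤ → Set
Even E = Σ ℤ λ m → E ≡ m ℤ.+ m

even-+ : ∀ {a b} → Even a → Even b → Even (a ℤ.+ b)
even-+ (m , refl) (m′ , refl) = m ℤ.+ m′ , lemma m m′
  where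
  lemma : ∀ m m′ → m ℤ.+ m ℤ.+ (m′ ℤ.+ m′) ≡ m ℤ.+ m′ ℤ.+ (m ℤ.+ m′)
  lemma = solve-∀

even≢+odd : ∀ {E} e → Even E → E ≢ + suc (2 * e)
even≢+odd e (+ p , refl) eq =
  even≢odd p e (trans (cong (λ t → p + t) (+-identityʳ p)) (ℤₚ.+-injective eq))
even≢+odd e (-[1+ p ] , refl) ()

even≢-odd : ∀ {E} e → Even E → E ≢ -[1+ 2 * e ]
even≢-odd e (+ p , refl) ()
even≢-odd e (-[1+ p ] , refl) eq =
  even≢odd e p (trans (sym (ℤₚ.-[1+-injective eq)) (cong (λ t → suc (p + t)) (sym (+-identityʳ p))))

-- The possible first edges, indexed by their displacement, of a tight walk of total displacement
-- E starting at an outer (resp. inner) vertex; distinct heads force distinct E.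
data OuterHead (E : ℤ) : ℤ → Set where
  spoke    : Even E → OuterHead E (+ 0)
  forward  : ∀ e → E ≡ + suc (2 * e) → OuterHead E (+ 1)
  backward : ∀ e → E ≡ -[1+ 2 * e ] → OuterHead E -[1+ 0 ]

data InnerHead (E : ℤ) : ℤ → Set where
  forward  : ∀ e → E ≡ + suc e → InnerHead E (+ 2)
  backward : ∀ e → E ≡ -[1+ e ] → InnerHead E -[1+ 1 ]

outerHead-unique : ∀ {E s t} → OuterHead E s → OuterHead E t → s ≡ t
outerHead-unique (spoke _)        (spoke _)        = refl
outerHead-unique (forward _ _)    (forward _ _)    = refl
outerHead-unique (backward _ _)   (backward _ _)   = refl
outerHead-unique (spoke ev)       (forward e eq)   = ⊥-elim (even≢+odd e ev eq)
outerHead-unique (spoke ev)       (backward e eq)  = ⊥-elim (even≢-odd e ev eq)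
outerHead-unique (forward e eq)   (spoke ev)       = ⊥-elim (even≢+odd e ev eq)
outerHead-unique (backward e eq)  (spoke ev)       = ⊥-elim (even≢-odd e ev eq)
outerHead-unique (forward _ refl) (backward _ ())
outerHead-unique (backward _ refl) (forward _ ())

innerHead-unique : ∀ {E s t} → InnerHead E s → InnerHead E t → s ≡ t
innerHead-unique (forward _ _)     (forward _ _)   = refl
innerHead-unique (backward _ _)    (backward _ _)  = refl
innerHead-unique (forward _ refl)  (backward _ ())
innerHead-unique (backward _ refl) (forward _ ())

-- Residues modulo 2k of least half distance

abs-inverse : ∀ {i m} → ∣ i ∣ ≡ m → i ≡ + m ⊎ i ≡ ℤ.- + m
abs-inverse {+ _}       refl = inj₁ refl
abs-inverse { -[1+ _ ]} refl = inj₂ refl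

∣i∣≡∣j∣⇒i≡j∨i≡-j : ∀ {i j} → ∣ i ∣ ≡ ∣ j ∣ → i ≡ j ⊎ i ≡ ℤ.- j
∣i∣≡∣j∣⇒i≡j∨i≡-j {i} {j} ∣i∣≡∣j∣ with abs-inverse ∣i∣≡∣j∣ | abs-inverse {j} refl
... | inj₁ i≡ | inj₁ j≡ = inj₁ (trans i≡ (sym j≡))
... | inj₂ i≡ | inj₂ j≡ = inj₁ (trans i≡ (sym j≡))
... | inj₁ i≡ | inj₂ j≡ = inj₂ (trans i≡ (trans (sym (ℤₚ.neg-involutive _)) (cong ℤ.-_ (sym j≡))))
... | inj₂ i≡ | inj₁ j≡ = inj₂ (trans i≡ (cong ℤ.-_ (sym j≡)))

halfDist-≤⇒∣∣<2+ : ∀ {x d} → halfDist x ≤ halfDist d → ∣ x ∣ < 2 + ∣ d ∣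
halfDist-≤⇒∣∣<2+ hx≤hd =
  ≰⇒> (λ 2+∣d∣≤∣x∣ → <-irrefl refl (≤-trans (⌈n/2⌉-mono 2+∣d∣≤∣x∣) hx≤hd))

2*k≡k+k : ∀ k → 2 * k ≡ k + k
2*k≡k+k k = cong (λ m → k + m) (+-identityʳ k)

k≤t*k<2+k⇒t*k≡k : ∀ t {k} → 2 ≤ k → k ≤ t * k → t * k < 2 + k → t * k ≡ k
k≤t*k<2+k⇒t*k≡k zero          (s≤s _) ()
k≤t*k<2+k⇒t*k≡k (suc zero)    {k} _   _ _ = +-identityʳ k
k≤t*k<2+k⇒t*k≡k (suc (suc t)) {k} 2≤k _ tk<2+k = ⊥-elim (<-irrefl refl (begin-strict
  k + 2             ≤⟨ +-monoʳ-≤ k 2≤k ⟩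
  k + k             ≤⟨ +-monoʳ-≤ k (m≤m+n k (t * k)) ⟩
  suc (suc t) * k   <⟨ tk<2+k ⟩
  2 + k             ≡⟨ +-comm 2 k ⟩
  k + 2             ∎))
  where open ≤-Reasoning

residue-far : ∀ {x d n} → x ≡ d mod n → x ≡ d ⊎ n ≤ ∣ x ∣ + ∣ d ∣
residue-far {x} {d} x≡d with mod-apart x≡d
... | inj₁ x≡d′      = inj₁ x≡d′
... | inj₂ n≤∣x-d∣   = inj₂ (≤-trans n≤∣x-d∣ (ℤₚ.∣i-j∣≤∣i∣+∣j∣ x d))

residue-∣∣-minimal : ∀ {k x d} → ∣ d ∣ ≤ k → x ≡ d mod (2 * k) → ∣ d ∣ ≤ ∣ x ∣
residue-∣∣-minimal {k} {x} {d} ∣d∣≤k x≡d with residue-far x≡d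
... | inj₁ refl = ≤-refl
... | inj₂ 2k≤∣x∣+∣d∣ = ≤-trans ∣d∣≤k (+-cancelʳ-≤ k k ∣ x ∣ (begin
  k + k           ≡⟨ 2*k≡k+k k ⟨
  2 * k           ≤⟨ 2k≤∣x∣+∣d∣ ⟩
  ∣ x ∣ + ∣ d ∣   ≤⟨ +-monoʳ-≤ ∣ x ∣ ∣d∣≤k ⟩
  ∣ x ∣ + k       ∎))
  where open ≤-Reasoning

residue-multiple : ∀ {k x d} → ∣ d ∣ ≡ k → x ≡ d mod (2 * k) → Σ ℕ λ t → ∣ x ∣ ≡ t * k
residue-multiple {k} {d = d} ∣d∣≡k (congruent m refl) with abs-inverse {d} ∣d∣≡k
... | inj₁ refl = ∣ + 1 ℤ.+ m ℤ.* + 2 ∣ ,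
  trans (cong (λ n → ∣ + k ℤ.+ m ℤ.* n ∣) (ℤₚ.pos-* 2 k))
        (trans (cong ∣_∣ (lemma (+ k) m)) (ℤₚ.abs-* (+ 1 ℤ.+ m ℤ.* + 2) (+ k)))
  where
  lemma : ∀ k m → k ℤ.+ m ℤ.* (+ 2 ℤ.* k) ≡ (+ 1 ℤ.+ m ℤ.* + 2) ℤ.* k
  lemma = solve-∀
... | inj₂ refl = ∣ -[1+ 0 ] ℤ.+ m ℤ.* + 2 ∣ ,
  trans (cong (λ n → ∣ ℤ.- + k ℤ.+ m ℤ.* n ∣) (ℤₚ.pos-* 2 k))
        (trans (cong ∣_∣ (lemma (+ k) m)) (ℤₚ.abs-* (-[1+ 0 ] ℤ.+ m ℤ.* + 2) (+ k)))
  where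
  lemma : ∀ k m → ℤ.- k ℤ.+ m ℤ.* (+ 2 ℤ.* k) ≡ (-[1+ 0 ] ℤ.+ m ℤ.* + 2) ℤ.* k
  lemma = solve-∀

residue-halfDist-minimal : ∀ {k x d} → 2 ≤ k → ∣ d ∣ ≤ k → x ≡ d mod (2 * k) →
                  halfDist x ≤ halfDist d → x ≡ d ⊎ (∣ d ∣ ≡ k × x ≡ ℤ.- d)
residue-halfDist-minimal {k} {x} {d} 2≤k ∣d∣≤k x≡d hx≤hd with residue-far x≡d | m≤n⇒m<n∨m≡n ∣d∣≤k
... | inj₁ x≡d′ | _ = inj₁ x≡d′
... | inj₂ 2k≤∣x∣+∣d∣ | inj₁ ∣d∣<k = ⊥-elim (<-irrefl refl (begin-strict
  2 + ∣ d ∣ + ∣ d ∣       ≡⟨ cong suc (+-suc ∣ d ∣ ∣ d ∣) ⟨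
  (suc ∣ d ∣) + (suc ∣ d ∣) ≤⟨ +-mono-≤ ∣d∣<k ∣d∣<k ⟩
  k + k                   ≡⟨ 2*k≡k+k k ⟨
  2 * k                   ≤⟨ 2k≤∣x∣+∣d∣ ⟩
  ∣ x ∣ + ∣ d ∣           <⟨ +-monoˡ-< ∣ d ∣ (halfDist-≤⇒∣∣<2+ {x} {d} hx≤hd) ⟩
  2 + ∣ d ∣ + ∣ d ∣       ∎))
  where open ≤-Reasoning
... | inj₂ _ | inj₂ ∣d∣≡k with t , ∣x∣≡tk ← residue-multiple ∣d∣≡k x≡d =
  map₂ (∣d∣≡k ,_) (∣i∣≡∣j∣⇒i≡j∨i≡-j (trans ∣x∣≡k (sym ∣d∣≡k)))
  where
  ∣x∣≡k : ∣ x ∣ ≡ k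
  ∣x∣≡k = trans ∣x∣≡tk (k≤t*k<2+k⇒t*k≡k t 2≤k
    (subst (k ≤_) ∣x∣≡tk (subst (_≤ ∣ x ∣) ∣d∣≡k (residue-∣∣-minimal ∣d∣≤k x≡d)))
    (subst (_< 2 + k) ∣x∣≡tk (subst (λ m → ∣ x ∣ < 2 + m) ∣d∣≡k (halfDist-≤⇒∣∣<2+ {x} {d} hx≤hd))))

i≢0⇒i≢-i : ∀ {i} → i ≢ + 0 → i ≢ ℤ.- i
i≢0⇒i≢-i {+0}       i≢0 _ = i≢0 refl
i≢0⇒i≢-i {+[1+ _ ]} _   ()
i≢0⇒i≢-i { -[1+ _ ]} _  ()

neg-≡-mod : ∀ {k d} → ∣ d ∣ ≡ k → ℤ.- d ≡ d mod (2 * k)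
neg-≡-mod {k} {d} ∣d∣≡k with abs-inverse {d} ∣d∣≡k
... | inj₁ refl = congruent -[1+ 0 ]
  (trans (lemma (+ k)) (cong (λ n → + k ℤ.+ -[1+ 0 ] ℤ.* n) (sym (ℤₚ.pos-* 2 k))))
  where
  lemma : ∀ k → ℤ.- k ≡ k ℤ.+ -[1+ 0 ] ℤ.* (+ 2 ℤ.* k)
  lemma = solve-∀
... | inj₂ refl = congruent (+ 1)
  (trans (lemma (+ k)) (cong (λ n → ℤ.- + k ℤ.+ + 1 ℤ.* n) (sym (ℤₚ.pos-* 2 k))))
  where
  lemma : ∀ k → ℤ.- ℤ.- k ≡ ℤ.- k ℤ.+ + 1 ℤ.* (+ 2 ℤ.* k)
  lemma = solve-∀

-- Walks in GP(n,2) lifted to the ladder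

module Ladder (n : ℕ) where

  index : V n → Fin n
  index (u a) = a
  index (v a) = a

  pos : V n → ℤ
  pos x = + toℕ (index x)

  δ : ∀ {x y} → Adj n x y → ℤ
  δ {u _} {u _} (inj₁ _) = + 1
  δ {u _} {u _} (inj₂ _) = -[1+ 0 ]
  δ {u _} {v _} _        = + 0
  δ {v _} {u _} _        = + 0
  δ {v _} {v _} (inj₁ _) = + 2
  δ {v _} {v _} (inj₂ _) = -[1+ 1 ]

  disp : ∀ {x z ps} → IsWalk n x z ps → ℤ
  disp here       = + 0
  disp (step a w) = δ a ℤ.+ disp w

  Step-congruent : ∀ {s a b} → Step n s a b → + s ≡ + toℕ b ℤ.- + toℕ a mod n
  Step-congruent {s} {a} {b} (inj₁ b≡a+s) =
    mod-reflexive (sym (trans (cong (λ t → + t ℤ.- + toℕ a) b≡a+s) (lemma (+ toℕ a) (+ s))))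
    where
    lemma : ∀ a s → a ℤ.+ s ℤ.- a ≡ s
    lemma = solve-∀
  Step-congruent {s} {a} {b} (inj₂ b+n≡a+s) = congruent (+ 1) (begin
    + s                              ≡⟨ lemma₁ (+ toℕ a) (+ s) ⟩
    + toℕ a ℤ.+ + s ℤ.- + toℕ a      ≡⟨ cong (λ t → + t ℤ.- + toℕ a) b+n≡a+s ⟨
    + toℕ b ℤ.+ + n ℤ.- + toℕ a      ≡⟨ lemma₂ (+ toℕ a) (+ toℕ b) (+ n) ⟩
    + toℕ b ℤ.- + toℕ a ℤ.+ + 1 ℤ.* + n ∎)
    where
    open ≡-Reasoning
    lemma₁ : ∀ a s → s ≡ a ℤ.+ s ℤ.- a
    lemma₁ = solve-∀
    lemma₂ : ∀ a b n → b ℤ.+ n ℤ.- a ≡ b ℤ.- a ℤ.+ + 1 ℤ.* n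
    lemma₂ = solve-∀

  edge-congruent : ∀ {x y} (a : Adj n x y) → δ a ≡ pos y ℤ.- pos x mod n
  edge-congruent {u _} {u _} (inj₁ s) = Step-congruent s
  edge-congruent {u x} {u y} (inj₂ s) = mod-flip {a = pos (u x)} {b = pos (u y)} (Step-congruent s)
  edge-congruent {u x} {v _} refl     = mod-reflexive (sym (ℤₚ.+-inverseʳ (pos (u x))))
  edge-congruent {v x} {u _} refl     = mod-reflexive (sym (ℤₚ.+-inverseʳ (pos (v x))))
  edge-congruent {v _} {v _} (inj₁ s) = Step-congruent s
  edge-congruent {v x} {v y} (inj₂ s) = mod-flip {a = pos (v x)} {b = pos (v y)} (Step-congruent s)

  walk-congruent : ∀ {x z ps} (w : IsWalk n x z ps) → disp w ≡ pos z ℤ.- pos x mod n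
  walk-congruent {x} here = mod-reflexive (sym (ℤₚ.+-inverseʳ (pos x)))
  walk-congruent {x} {z} (step {y = y} a w) =
    mod-resp refl (telescope (pos x) (pos y) (pos z)) (mod-+ (edge-congruent a) (walk-congruent w))
    where
    telescope : ∀ x y z → y ℤ.- x ℤ.+ (z ℤ.- y) ≡ z ℤ.- x
    telescope = solve-∀

  index-unique : ∀ {x y z} → pos y ℤ.- pos x ≡ pos z ℤ.- pos x mod n → index y ≡ index z
  index-unique {x} {y} {z} y-x≡z-x =
    toℕ-injective (mod-injective (toℕ<n (index y)) (toℕ<n (index z))
      (mod-cancelʳ {pos y} {pos z} {pos x} y-x≡z-x))

  edge-index-unique : ∀ {x y z} (a : Adj n x y) (b : Adj n x z) → δ a ≡ δ b → index y ≡ index z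
  edge-index-unique {x} {y} {z} a b δa≡δb = index-unique {x} {y} {z}
    (mod-trans (mod-sym (edge-congruent a))
               (subst (λ t → t ≡ pos z ℤ.- pos x mod n) (sym δa≡δb) (edge-congruent b)))

  edge-target-unique : ∀ {x y z} (a : Adj n x y) (b : Adj n x z) → δ a ≡ δ b → y ≡ z
  edge-target-unique {y = u _} {u _} a b δa≡δb = cong u (edge-index-unique a b δa≡δb)
  edge-target-unique {y = v _} {v _} a b δa≡δb = cong v (edge-index-unique a b δa≡δb)
  edge-target-unique {u _} {u _} {v _} (inj₁ _) _ ()
  edge-target-unique {u _} {u _} {v _} (inj₂ _) _ ()
  edge-target-unique {u _} {v _} {u _} _ (inj₁ _) ()
  edge-target-unique {u _} {v _} {u _} _ (inj₂ _) ()
  edge-target-unique {v _} {u _} {v _} _ (inj₁ _) ()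
  edge-target-unique {v _} {u _} {v _} _ (inj₂ _) ()
  edge-target-unique {v _} {v _} {u _} (inj₁ _) _ ()
  edge-target-unique {v _} {v _} {u _} (inj₂ _) _ ()

  Step-round-trip : ∀ {s a b} → Step n s a b → Step n s b a → + (s + s) ≡ + 0 mod n
  Step-round-trip {s} {a} {b} ab ba =
    mod-resp refl (lemma (+ toℕ a) (+ toℕ b))
      (mod-+ {+ s} {+ toℕ b ℤ.- + toℕ a} {+ s} {+ toℕ a ℤ.- + toℕ b}
             (Step-congruent ab) (Step-congruent ba))
    where
    lemma : ∀ a b → b ℤ.- a ℤ.+ (a ℤ.- b) ≡ + 0
    lemma = solve-∀

  Step-not-both-ways : ∀ {s a b} → 1 ≤ s → s ≤ 2 → 5 ≤ n → Step n s a b → Step n s b a → ⊥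
  Step-not-both-ways {suc _} _ s≤2 5≤n ab ba =
    1+n≢0 (mod-injective 2s<n (≤-<-trans z≤n 2s<n) (Step-round-trip ab ba))
    where
    2s<n = <-≤-trans (s≤s (+-mono-≤ s≤2 s≤2)) 5≤n

  -- For n = 4 an inner edge v_a v_{a+2} is also v_a v_{a-2}, so its displacement is ambiguous.
  δ-irrelevant : 5 ≤ n → ∀ {x y} (a b : Adj n x y) → δ a ≡ δ b
  δ-irrelevant _   {u _} {u _} (inj₁ _)  (inj₁ _)  = refl
  δ-irrelevant _   {u _} {u _} (inj₂ _)  (inj₂ _)  = refl
  δ-irrelevant 5≤n {u _} {u _} (inj₁ ab) (inj₂ ba) = ⊥-elim (Step-not-both-ways (s≤s z≤n) (s≤s z≤n) 5≤n ab ba)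
  δ-irrelevant 5≤n {u _} {u _} (inj₂ ba) (inj₁ ab) = ⊥-elim (Step-not-both-ways (s≤s z≤n) (s≤s z≤n) 5≤n ab ba)
  δ-irrelevant _   {u _} {v _} _         _         = refl
  δ-irrelevant _   {v _} {u _} _         _         = refl
  δ-irrelevant _   {v _} {v _} (inj₁ _)  (inj₁ _)  = refl
  δ-irrelevant _   {v _} {v _} (inj₂ _)  (inj₂ _)  = refl
  δ-irrelevant 5≤n {v _} {v _} (inj₁ ab) (inj₂ ba) = ⊥-elim (Step-not-both-ways (s≤s z≤n) ≤-refl 5≤n ab ba)
  δ-irrelevant 5≤n {v _} {v _} (inj₂ ba) (inj₁ ab) = ⊥-elim (Step-not-both-ways (s≤s z≤n) ≤-refl 5≤n ab ba)

  walk-source-unique : ∀ {x x′ z z′ ps} → IsWalk n x z ps → IsWalk n x′ z′ ps → x ≡ x′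
  walk-source-unique here       here       = refl
  walk-source-unique here       (step _ _) = refl
  walk-source-unique (step _ _) here       = refl
  walk-source-unique (step _ _) (step _ _) = refl

  disp-irrelevant : 5 ≤ n → ∀ {x z ps} (w₁ w₂ : IsWalk n x z ps) → disp w₁ ≡ disp w₂
  disp-irrelevant 5≤n here         here         = refl
  disp-irrelevant 5≤n (step a₁ w₁) (step a₂ w₂) with refl ← walk-source-unique w₁ w₂ =
    cong₂ ℤ._+_ (δ-irrelevant 5≤n a₁ a₂) (disp-irrelevant 5≤n w₁ w₂)

  -- Distance in the ladder from the lift of x to the inner vertex D positions further along.
  ladderDist : V n → ℤ → ℕ
  ladderDist (u _) D = suc (halfDist D)
  ladderDist (v _) D = halfDist D

  ladderDist-edge : ∀ {x y} (a : Adj n x y) D → ladderDist x (δ a ℤ.+ D) ≤ suc (ladderDist y D)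
  ladderDist-edge {u _} {u _} (inj₁ _) D = s≤s (halfDist-+-≤ (+ 1) D (s≤s z≤n))
  ladderDist-edge {u _} {u _} (inj₂ _) D = s≤s (halfDist-+-≤ -[1+ 0 ] D (s≤s z≤n))
  ladderDist-edge {u _} {v _} _        D = s≤s (≤-reflexive (cong halfDist (ℤₚ.+-identityˡ D)))
  ladderDist-edge {v _} {u _} _        D = m≤n⇒m≤1+n (halfDist-+-≤ (+ 0) D z≤n)
  ladderDist-edge {v _} {v _} (inj₁ _) D = halfDist-+-≤ (+ 2) D ≤-refl
  ladderDist-edge {v _} {v _} (inj₂ _) D = halfDist-+-≤ -[1+ 1 ] D ≤-refl

  ladderDist<length : ∀ {x j ps} (w : IsWalk n x (v j) ps) → suc (ladderDist x (disp w)) ≤ length ps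
  ladderDist<length here       = s≤s z≤n
  ladderDist<length (step a w) = s≤s (≤-trans (ladderDist-edge a (disp w)) (ladderDist<length w))

  Tight : ∀ {x z ps} → IsWalk n x z ps → Set
  Tight {x} {ps = ps} w = length ps ≡ suc (ladderDist x (disp w))

  TightEdge : ∀ {x y} → Adj n x y → ℤ → Set
  TightEdge {x} {y} a D = ladderDist x (δ a ℤ.+ D) ≡ suc (ladderDist y D)

  tight-split : ∀ {x y j ps} (a : Adj n x y) (w : IsWalk n y (v j) ps) →
                Tight (step a w) → TightEdge {x} {y} a (disp w) × Tight w
  tight-split a w t = edge , trans length≡ edge
    where
    length≡ = suc-injective t
    edge = ≤-antisym (ladderDist-edge a (disp w)) (subst (suc _ ≤_) length≡ (ladderDist<length w))

  tight-cons : ∀ {x y z ps} (a : Adj n x y) (w : IsWalk n y z ps) →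
               TightEdge {x} {y} a (disp w) → Tight w → Tight (step a w)
  tight-cons a w edge t = cong suc (trans t (sym edge))

  inner-spoke-not-tight : ∀ {x y} (a : Adj n (v x) (u y)) D → ¬ TightEdge {v x} {u y} a D
  inner-spoke-not-tight a D edge = n≢2+n (trans (cong halfDist (sym (ℤₚ.+-identityˡ D))) edge)

  tight-inner-even : ∀ {x j ps} (w : IsWalk n (v x) (v j) ps) → Tight w → Even (disp w)
  tight-inner-even here _ = + 0 , refl
  tight-inner-even {x} (step {y = u y} a w) t =
    ⊥-elim (inner-spoke-not-tight {x} {y} a (disp w) (proj₁ (tight-split {v x} a w t)))
  tight-inner-even {x} (step {y = v _} a@(inj₁ _) w) t =
    even-+ (+ 1 , refl) (tight-inner-even w (proj₂ (tight-split {v x} a w t)))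
  tight-inner-even {x} (step {y = v _} a@(inj₂ _) w) t =
    even-+ (-[1+ 0 ] , refl) (tight-inner-even w (proj₂ (tight-split {v x} a w t)))

  tight-outer-head : ∀ {x y j ps} (a : Adj n (u x) y) (w : IsWalk n y (v j) ps) →
                     Tight (step a w) → OuterHead (δ a ℤ.+ disp w) (δ a)
  tight-outer-head {x} {u _} a@(inj₁ _) w t =
    uncurry OuterHead.forward (halfDist-tight-+1 (disp w) (suc-injective (proj₁ (tight-split {u x} a w t))))
  tight-outer-head {x} {u _} a@(inj₂ _) w t =
    uncurry OuterHead.backward (halfDist-tight--1 (disp w) (suc-injective (proj₁ (tight-split {u x} a w t))))
  tight-outer-head {x} {v _} refl w t =
    spoke (subst Even (sym (ℤₚ.+-identityˡ (disp w))) (tight-inner-even w (proj₂ (tight-split {u x} refl w t))))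

  tight-inner-head : ∀ {x y j ps} (a : Adj n (v x) y) (w : IsWalk n y (v j) ps) →
                     Tight (step a w) → InnerHead (δ a ℤ.+ disp w) (δ a)
  tight-inner-head {x} {u y} a w t =
    ⊥-elim (inner-spoke-not-tight {x} {y} a (disp w) (proj₁ (tight-split {v x} a w t)))
  tight-inner-head {x} {v _} a@(inj₁ _) w t =
    uncurry InnerHead.forward (halfDist-tight-+2 (disp w) (proj₁ (tight-split {v x} a w t)))
  tight-inner-head {x} {v _} a@(inj₂ _) w t =
    uncurry InnerHead.backward (halfDist-tight--2 (disp w) (proj₁ (tight-split {v x} a w t)))

  tight-δ-unique : ∀ {x y z j ps qs} (a : Adj n x y) (b : Adj n x z)
                   (w₁ : IsWalk n y (v j) ps) (w₂ : IsWalk n z (v j) qs) →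
                   δ a ℤ.+ disp w₁ ≡ δ b ℤ.+ disp w₂ →
                   Tight (step a w₁) → Tight (step b w₂) → δ a ≡ δ b
  tight-δ-unique {u _} a b w₁ w₂ eq t₁ t₂ = outerHead-unique
    (subst (λ E → OuterHead E (δ a)) eq (tight-outer-head a w₁ t₁)) (tight-outer-head b w₂ t₂)
  tight-δ-unique {v _} a b w₁ w₂ eq t₁ t₂ = innerHead-unique
    (subst (λ E → InnerHead E (δ a)) eq (tight-inner-head a w₁ t₁)) (tight-inner-head b w₂ t₂)

  walk-nonempty : ∀ {x z ps} → IsWalk n x z ps → length ps ≢ 0
  walk-nonempty here       ()
  walk-nonempty (step _ _) ()

  tight-length-unique : ∀ {x z ps qs} (w₁ : IsWalk n x z ps) (w₂ : IsWalk n x z qs) →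
                        disp w₁ ≡ disp w₂ → Tight w₁ → Tight w₂ → length ps ≡ length qs
  tight-length-unique {x} _ _ d t₁ t₂ = trans t₁ (trans (cong (λ D → suc (ladderDist x D)) d) (sym t₂))

  tight-unique : ∀ {x j ps qs} (w₁ : IsWalk n x (v j) ps) (w₂ : IsWalk n x (v j) qs) →
                 disp w₁ ≡ disp w₂ → Tight w₁ → Tight w₂ → ps ≡ qs
  tight-unique here here _ _ _ = refl
  tight-unique here w₂@(step _ w) d t₁ t₂ =
    ⊥-elim (walk-nonempty w (suc-injective (sym (tight-length-unique here w₂ d t₁ t₂))))
  tight-unique w₁@(step _ w) here d t₁ t₂ =
    ⊥-elim (walk-nonempty w (suc-injective (tight-length-unique w₁ here d t₁ t₂)))
  tight-unique (step a w₁) (step b w₂) d t₁ t₂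
    with δa≡δb ← tight-δ-unique a b w₁ w₂ d t₁ t₂
    with refl ← edge-target-unique a b δa≡δb =
    cong (_ ∷_) (tight-unique w₁ w₂ (+-cancelˡ-ℤ (δ b) _ _ (trans (cong (ℤ._+ disp w₁) (sym δa≡δb)) d))
                              (proj₂ (tight-split a w₁ t₁)) (proj₂ (tight-split b w₂ t₂)))

  Step-forward : ∀ s → s ≤ n → (a : Fin n) → Σ (Fin n) (Step n s a)
  Step-forward s s≤n a with toℕ a + s <? n
  ... | yes a+s<n = fromℕ< a+s<n , inj₁ (toℕ-fromℕ< a+s<n)
  ... | no  a+s≮n = fromℕ< wrapped<n , inj₂ (trans (cong (_+ n) (toℕ-fromℕ< wrapped<n)) (m∸n+n≡m n≤a+s))
    where
    n≤a+s : n ≤ toℕ a + s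
    n≤a+s = ≮⇒≥ a+s≮n
    wrapped<n : toℕ a + s ∸ n < n
    wrapped<n = subst (toℕ a + s ∸ n <_) (m+n∸n≡m n n) (∸-monoˡ-< (+-mono-<-≤ (toℕ<n a) s≤n) n≤a+s)

  Step-backward : ∀ s → s ≤ n → (a : Fin n) → Σ (Fin n) λ b → Step n s b a
  Step-backward s s≤n a with s ≤? toℕ a
  ... | yes s≤a = fromℕ< a-s<n , inj₁ (sym (trans (cong (_+ s) (toℕ-fromℕ< a-s<n)) (m∸n+n≡m s≤a)))
    where
    a-s<n : toℕ a ∸ s < n
    a-s<n = ≤-<-trans (m∸n≤m (toℕ a) s) (toℕ<n a)
  ... | no  s≰a = fromℕ< wrapped<n , inj₂ (sym (trans (cong (_+ s) (toℕ-fromℕ< wrapped<n)) (m∸n+n≡m s≤a+n)))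
    where
    s≤a+n : s ≤ toℕ a + n
    s≤a+n = ≤-trans s≤n (m≤n+m n (toℕ a))
    wrapped<n : toℕ a + n ∸ s < n
    wrapped<n = subst (toℕ a + n ∸ s <_) (m+n∸m≡n s n) (∸-monoˡ-< (+-monoˡ-< n (≰⇒> s≰a)) s≤a+n)

  TightWalkFrom : V n → ℤ → Set
  TightWalkFrom x D =
    Σ (Fin n) λ j → Σ (List (V n)) λ ps → Σ (IsWalk n x (v j) ps) λ w → disp w ≡ D × Tight w

  tight-extend : ∀ {x y D} (a : Adj n x y) → TightEdge {x} {y} a D →
                 TightWalkFrom y D → TightWalkFrom x (δ a ℤ.+ D)
  tight-extend {x} a edge (j , ps , w , refl , t) = j , x ∷ ps , step a w , refl , tight-cons a w edge t

  tight-spoke : ∀ {x D} → TightWalkFrom (v x) D → TightWalkFrom (u x) D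
  tight-spoke {x} {D} walk = subst (TightWalkFrom (u x)) (ℤₚ.+-identityˡ D)
    (tight-extend refl (cong (λ E → suc (halfDist E)) (ℤₚ.+-identityˡ D)) walk)

  module _ (2≤n : 2 ≤ n) where

    inner-forward : ∀ x m → TightWalkFrom (v x) (+ (m + m))
    inner-forward x zero    = x , _ , here , refl , refl
    inner-forward x (suc m) with y , x→y ← Step-forward 2 2≤n x =
      subst (λ p → TightWalkFrom (v x) (+ p)) (cong suc (sym (+-suc m m)))
        (tight-extend (inj₁ x→y) refl (inner-forward y m))

    inner-backward : ∀ x m → TightWalkFrom (v x) (ℤ.- + (m + m))
    inner-backward x zero    = x , _ , here , refl , refl
    inner-backward x (suc m) with y , y→x ← Step-backward 2 2≤n x =
      subst (TightWalkFrom (v x)) (trans (-[1+m]-n≡-[1+m+n] 1 (m + m)) (cong -[1+_] (sym (+-suc m m))))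
        (tight-extend (inj₂ y→x) edge (inner-backward y m))
      where
      edge : TightEdge {v x} {v y} (inj₂ y→x) (ℤ.- + (m + m))
      edge = trans (cong halfDist (-[1+m]-n≡-[1+m+n] 1 (m + m))) (cong suc (sym (halfDist-neg (+ (m + m)))))

    outer-forward : ∀ x q → TightWalkFrom (u x) (+ q)
    outer-forward x q with parity q
    ... | m , inj₁ refl = tight-spoke (inner-forward x m)
    ... | m , inj₂ refl with y , x→y ← Step-forward 1 (≤-trans (s≤s z≤n) 2≤n) x =
      tight-extend (inj₁ x→y) (cong suc (⌈1+n+n/2⌉≡1+⌈n+n/2⌉ m)) (tight-spoke (inner-forward y m))

    outer-backward : ∀ x q → TightWalkFrom (u x) (ℤ.- + q)
    outer-backward x q with parity q
    ... | m , inj₁ refl = tight-spoke (inner-backward x m)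
    ... | m , inj₂ refl with y , y→x ← Step-backward 1 (≤-trans (s≤s z≤n) 2≤n) x =
      subst (TightWalkFrom (u x)) (-[1+m]-n≡-[1+m+n] 0 (m + m))
        (tight-extend (inj₂ y→x) edge (tight-spoke (inner-backward y m)))
      where
      edge : TightEdge {u x} {u y} (inj₂ y→x) (ℤ.- + (m + m))
      edge = cong suc (trans (cong halfDist (-[1+m]-n≡-[1+m+n] 0 (m + m)))
                             (trans (⌈1+n+n/2⌉≡1+⌈n+n/2⌉ m) (cong suc (sym (halfDist-neg (+ (m + m)))))))

    tight-walk-exists : ∀ x D → TightWalkFrom (u x) D
    tight-walk-exists x (+ q)    = outer-forward x q
    tight-walk-exists x -[1+ q ] = outer-backward x (suc q)

-- Geodesics between u_i and v_j in GP(2k,2)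

numGeodesics-1 : ∀ {m x y ps} → IsGeodesic m x y ps →
                 (∀ qs → IsGeodesic m x y qs → qs ≡ ps) → NumGeodesics m x y 1
numGeodesics-1 {ps = ps} g only-g = ps ∷ [] , refl , [] ∷ [] , g ∷ [] , λ qs gq → here (only-g qs gq)

numGeodesics-2 : ∀ {m x y ps qs} → IsGeodesic m x y ps → IsGeodesic m x y qs → ps ≢ qs →
                 (∀ rs → IsGeodesic m x y rs → rs ≡ ps ⊎ rs ≡ qs) → NumGeodesics m x y 2
numGeodesics-2 {ps = ps} {qs} gp gq ps≢qs only-gp-gq =
  ps ∷ qs ∷ [] , refl , (ps≢qs ∷ []) ∷ [] ∷ [] , gp ∷ gq ∷ [] ,
  λ rs gr → [ here , (λ rs≡qs → there (here rs≡qs)) ]′ (only-gp-gq rs gr)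

module Geodesics (k : ℕ) (3≤k : 3 ≤ k) (i j : Fin (2 * k)) (r≤k : ∣ toℕ i - toℕ j ∣ ≤ k) where

  open Ladder (2 * k)

  r : ℕ
  r = ∣ toℕ i - toℕ j ∣

  D₀ : ℤ
  D₀ = + toℕ j ℤ.- + toℕ i

  ∣D₀∣≡r : ∣ D₀ ∣ ≡ r
  ∣D₀∣≡r = trans (∣+m-+n∣≡∣m-n∣ (toℕ j) (toℕ i)) (∣-∣-comm (toℕ j) (toℕ i))

  ∣D₀∣≤k : ∣ D₀ ∣ ≤ k
  ∣D₀∣≤k = subst (_≤ k) (sym ∣D₀∣≡r) r≤k

  2≤k : 2 ≤ k
  2≤k = ≤-trans (s≤s (s≤s z≤n)) 3≤k

  2≤n : 2 ≤ 2 * k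
  2≤n = ≤-trans 2≤k (m≤m+n k (k + 0))

  5≤n : 5 ≤ 2 * k
  5≤n = subst (5 ≤_) (sym (2*k≡k+k k)) (+-mono-≤ 2≤k 3≤k)

  disp≡D₀ : ∀ {ps} (w : IsWalk (2 * k) (u i) (v j) ps) → disp w ≡ D₀ mod (2 * k)
  disp≡D₀ = walk-congruent

  2+⌈r/2⌉≤length : ∀ {ps} (w : IsWalk (2 * k) (u i) (v j) ps) → suc (suc ⌈ r /2⌉) ≤ length ps
  2+⌈r/2⌉≤length w = ≤-trans (s≤s (s≤s (⌈n/2⌉-mono r≤∣disp∣))) (ladderDist<length w)
    where
    r≤∣disp∣ = subst (_≤ ∣ disp w ∣) ∣D₀∣≡r (residue-∣∣-minimal ∣D₀∣≤k (disp≡D₀ w))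

  CanonicalWalk : ℤ → Set
  CanonicalWalk D = Σ (List (V (2 * k))) λ ps → Σ (IsWalk (2 * k) (u i) (v j) ps) λ w → disp w ≡ D × Tight w

  canonical : ∀ {D} → D ≡ D₀ mod (2 * k) → CanonicalWalk D
  canonical {D} D≡D₀ with y , ps , w , refl , t ← tight-walk-exists 2≤n i D
    with refl ← index-unique {u i} {v y} {v j} (mod-trans (mod-sym (walk-congruent w)) D≡D₀) =
    ps , w , refl , t

  canonical-length : ∀ {D} (c : CanonicalWalk D) → length (proj₁ c) ≡ suc (suc (halfDist D))
  canonical-length (_ , _ , refl , t) = t

  canonical-geodesic : ∀ {D} (c : CanonicalWalk D) → ∣ D ∣ ≡ r → IsGeodesic (2 * k) (u i) (v j) (proj₁ c)
  canonical-geodesic c ∣D∣≡r = proj₁ (proj₂ c) , λ qs wq →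
    ≤-trans (≤-reflexive (trans (canonical-length c) (cong (λ m → suc (suc ⌈ m /2⌉)) ∣D∣≡r)))
            (2+⌈r/2⌉≤length wq)

  c₀ : CanonicalWalk D₀
  c₀ = canonical (mod-reflexive refl)

  geodesic-classification : ∀ {ps} (g : IsGeodesic (2 * k) (u i) (v j) ps) →
    Tight (proj₁ g) × (disp (proj₁ g) ≡ D₀ ⊎ (r ≡ k × disp (proj₁ g) ≡ ℤ.- D₀))
  geodesic-classification {ps} (w , minimal) = tight , classes
    where
    length≤ : length ps ≤ suc (suc (halfDist D₀))
    length≤ = ≤-trans (minimal _ (proj₁ (proj₂ c₀))) (≤-reflexive (canonical-length c₀))
    classes = map₂ (map₁ (trans (sym ∣D₀∣≡r))) (residue-halfDist-minimal 2≤k ∣D₀∣≤k (disp≡D₀ w)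
                (≤-pred (≤-pred (≤-trans (ladderDist<length w) length≤))))
    ∣disp∣≡∣D₀∣ : ∣ disp w ∣ ≡ ∣ D₀ ∣
    ∣disp∣≡∣D₀∣ = [ cong ∣_∣ , (λ (_ , disp≡-D₀) → trans (cong ∣_∣ disp≡-D₀) (ℤₚ.∣-i∣≡∣i∣ D₀)) ]′
                  classes
    tight : Tight w
    tight = ≤-antisym (≤-trans length≤ (≤-reflexive (cong (λ m → suc (suc ⌈ m /2⌉)) (sym ∣disp∣≡∣D₀∣))))
                      (ladderDist<length w)

  geodesic-is-canonical : ∀ {ps D} (g : IsGeodesic (2 * k) (u i) (v j) ps) → Tight (proj₁ g) →
                          disp (proj₁ g) ≡ D → (c : CanonicalWalk D) → ps ≡ proj₁ c
  geodesic-is-canonical (w , _) t refl (_ , w′ , d′ , t′) = tight-unique w w′ (sym d′) t t′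

  canonical-disp-injective : ∀ {D D′} (c : CanonicalWalk D) (c′ : CanonicalWalk D′) →
                             proj₁ c ≡ proj₁ c′ → D ≡ D′
  canonical-disp-injective (_ , w , refl , _) (_ , w′ , refl , _) refl = disp-irrelevant 5≤n w w′

  one-geodesic : r < k → NumGeodesics (2 * k) (u i) (v j) 1
  one-geodesic r<k = numGeodesics-1 (canonical-geodesic c₀ ∣D₀∣≡r) only-c₀
    where
    only-c₀ : ∀ qs → IsGeodesic (2 * k) (u i) (v j) qs → qs ≡ proj₁ c₀
    only-c₀ qs g with geodesic-classification g
    ... | t , inj₁ disp≡D₀      = geodesic-is-canonical g t disp≡D₀ c₀
    ... | _ , inj₂ (r≡k , _)    = ⊥-elim (<-irrefl r≡k r<k)

  two-geodesics : r ≡ k → NumGeodesics (2 * k) (u i) (v j) 2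
  two-geodesics r≡k =
    numGeodesics-2 (canonical-geodesic c₀ ∣D₀∣≡r) (canonical-geodesic c₁ ∣-D₀∣≡r)
                   (λ c₀≡c₁ → D₀≢-D₀ (canonical-disp-injective c₀ c₁ c₀≡c₁)) only-c₀-c₁
    where
    ∣D₀∣≡k : ∣ D₀ ∣ ≡ k
    ∣D₀∣≡k = trans ∣D₀∣≡r r≡k
    ∣-D₀∣≡r : ∣ ℤ.- D₀ ∣ ≡ r
    ∣-D₀∣≡r = trans (ℤₚ.∣-i∣≡∣i∣ D₀) ∣D₀∣≡r
    c₁ : CanonicalWalk (ℤ.- D₀)
    c₁ = canonical (neg-≡-mod ∣D₀∣≡k)
    D₀≢-D₀ : D₀ ≢ ℤ.- D₀
    D₀≢-D₀ = i≢0⇒i≢-i (λ D₀≡0 →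
      <⇒≱ 3≤k (subst (_≤ 2) (trans (cong ∣_∣ (sym D₀≡0)) ∣D₀∣≡k) z≤n))
    only-c₀-c₁ : ∀ qs → IsGeodesic (2 * k) (u i) (v j) qs → qs ≡ proj₁ c₀ ⊎ qs ≡ proj₁ c₁
    only-c₀-c₁ qs g with geodesic-classification g
    ... | t , inj₁ disp≡D₀          = inj₁ (geodesic-is-canonical g t disp≡D₀ c₀)
    ... | t , inj₂ (_ , disp≡-D₀)   = inj₂ (geodesic-is-canonical g t disp≡-D₀ c₁)

mainTheorem8 : (k : ℕ) → 3 ≤ k → (i j : Fin (2 * k)) →
    ∣ toℕ i - toℕ j ∣ ≤ k →
    (∣ toℕ i - toℕ j ∣ < k → NumGeodesics (2 * k) (u i) (v j) 1) ×
    (∣ toℕ i - toℕ j ∣ ≡ k → NumGeodesics (2 * k) (u i) (v j) 2)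
mainTheorem8 k 3≤k i j r≤k = one-geodesic , two-geodesics
  where open Geodesics k 3≤k i j r≤k
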